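{- Let $\mathscr{D}$ be a commutative variety of algebras such that the full subcategory $\mathscr{D}_f$ of finitely presentable objects is closed under subobjects, strong quotients and finite products, let $X,Y$ be objects of $\mathscr{D}$, and let $L:X^{\circledast}\to Y$ be a language. The following are equivalent: (a) $L$ is $\mathscr{D}$-regular; (b) the minimal $\mathscr{D}$-automaton $\mathrm{Min}\,L$ has a finitely presentable carrier; (c) $L$ is recognized by some $\mathscr{D}$-monoid with finitely presentable carrier; (d) the syntactic $\mathscr{D}$-monoid $\mathrm{Syn}\,L$ has a finitely presentable carrier.
   Context: $\mathscr{D}$ commutative variety: the homomorphisms $A\to B$ form a subalgebra $[A,B]$ of $B^{|A|}$; $\mathscr{D}$ has tensor products $\otimes$ representing bimorphisms, unit $I=\Psi 1$, and is symmetric monoidal closed. An object is finitely presentable if it is an algebra presentable by finitely many generators and relations. A $\mathscr{D}$-monoid is an algebra with a monoid structure whose multiplication is a bimorphism. $X^{\circledast}=\coprod_n X^{\otimes n}$ is the free $\mathscr{D}$-monoid on $X$ (unit $i_X$, multiplication $m_X$, universal arrow $\eta_X$). A language is a $\mathscr{D}$-morphism $L:X^{\circledast}\to Y$. A $\mathscr{D}$-automaton $(Q,\delta,i,f)$: $\delta:X\otimes Q\to Q$, $i:I\to Q$, $f:Q\to Y$; it accepts $f\cdot e_Q$ where $e_Q$ is the unique homomorphism from the initial algebra $(X^{\circledast},[i_X,m_X\cdot(\eta_X\otimes X^{\circledast})])$ for $FQ=I+X\otimes Q$. $L$ is $\mathscr{D}$-regular if it is accepted by some $\mathscr{D}$-automaton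 with finitely presentable state object. $\mathrm{Min}\,L$ is the (unique up to isomorphism) reachable ($e_Q$ surjective) and simple (the unique coalgebra homomorphism into the final coalgebra $[X^{\circledast},Y]$ for $TQ=Y\times[X,Q]$, $q\mapsto(x\mapsto f(\delta^{\circledast}(x,q)))$, is injective) automaton accepting $L$. A $\mathscr{D}$-monoid morphism $e:X^{\circledast}\to M$ recognizes $L$ if $L=g\cdot e$ for some $\mathscr{D}$-morphism $g$; $\mathrm{Syn}\,L$ is the smallest surjective $\mathscr{D}$-monoid morphism out of $X^{\circledast}$ (ordered by factorization) recognizing $L$. -}

module Defs where

open import Data.Nat using (ℕ)
open import Data.Fin using (Fin)
open import Data.List using (List)
open import Data.List.Membership.Propositional using (_∈_)
open import Data.Product using (Σ; Σ-syntax; ∃; _×_; _,_; proj₁; proj₂)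
open import Data.Unit using (⊤; tt)
open import Relation.Binary using (IsEquivalence)

data Term {Op : Set} (ar : Op → ℕ) (V : Set) : Set where
  var : V → Term ar V
  op  : (o : Op) → (Fin (ar o) → Term ar V) → Term ar V

evalWith : ∀ {Op : Set} {ar : Op → ℕ} {V C : Set} →
           ((o : Op) → (Fin (ar o) → C) → C) → (V → C) → Term ar V → C
evalWith f ρ (var v)   = ρ v
evalWith f ρ (op o ts) = f o (λ i → evalWith f ρ (ts i))

record Variety : Set₁ where
  field
    Op  : Set
    ar  : Op → ℕ
    Ax  : Set
    lhs : Ax → Term ar ℕ
    rhs : Ax → Term ar ℕ

module Over (𝒱 : Variety) where
  open Variety 𝒱

  record Alg : Set₁ where
    field
      Carrier : Set
      _≈_     : Carrier → Carrier → Set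
      isEquiv : IsEquivalence _≈_
      ⟦_⟧     : (o : Op) → (Fin (ar o) → Carrier) → Carrier
      ⟦⟧-cong : ∀ o {xs ys : Fin (ar o) → Carrier} →
                (∀ i → xs i ≈ ys i) → ⟦ o ⟧ xs ≈ ⟦ o ⟧ ys
      sound   : ∀ (a : Ax) (ρ : ℕ → Carrier) →
                evalWith ⟦_⟧ ρ (lhs a) ≈ evalWith ⟦_⟧ ρ (rhs a)

  ∣_∣ : Alg → Set
  ∣ A ∣ = Alg.Carrier A

  Eq : (A : Alg) → ∣ A ∣ → ∣ A ∣ → Set
  Eq A = Alg._≈_ A

  IsHom : (A B : Alg) → (∣ A ∣ → ∣ B ∣) → Set
  IsHom A B h =
    (∀ {x y} → Eq A x y → Eq B (h x) (h y)) ×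
    (∀ o (xs : Fin (ar o) → ∣ A ∣) →
       Eq B (h (Alg.⟦_⟧ A o xs)) (Alg.⟦_⟧ B o (λ i → h (xs i))))

  Hom : Alg → Alg → Set
  Hom A B = Σ (∣ A ∣ → ∣ B ∣) (IsHom A B)

  -- commutative variety: homomorphisms A → B form a subalgebra of B^|A|,
  -- i.e. the pointwise operation on homomorphisms yields a homomorphism
  Commutative : Set₁
  Commutative = ∀ (A B : Alg) (o : Op) (hs : Fin (ar o) → Hom A B) →
    IsHom A B (λ a → Alg.⟦_⟧ B o (λ i → proj₁ (hs i) a))

  Injective : (A B : Alg) → (∣ A ∣ → ∣ B ∣) → Set
  Injective A B h = ∀ x y → Eq B (h x) (h y) → Eq A x y

  Surjective : (A B : Alg) → (∣ A ∣ → ∣ B ∣) → Set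
  Surjective A B h = ∀ b → Σ ∣ A ∣ λ a → Eq B (h a) b

  Iso : Alg → Alg → Set
  Iso A B = Σ (Hom A B) λ h → Σ (Hom B A) λ k →
    (∀ b → Eq B (proj₁ h (proj₁ k b)) b) × (∀ a → Eq A (proj₁ k (proj₁ h a)) a)

  Rels : ℕ → Set
  Rels n = List (Term ar (Fin n) × Term ar (Fin n))

  data Cong (n : ℕ) (R : Rels n) : Term ar (Fin n) → Term ar (Fin n) → Set where
    c-refl  : ∀ {t} → Cong n R t t
    c-sym   : ∀ {t u} → Cong n R t u → Cong n R u t
    c-trans : ∀ {t u v} → Cong n R t u → Cong n R u v → Cong n R t v
    c-cong  : ∀ o {ts us : Fin (ar o) → Term ar (Fin n)} →
              (∀ i → Cong n R (ts i) (us i)) → Cong n R (op o ts) (op o us)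
    c-rel   : ∀ {p} → p ∈ R → Cong n R (proj₁ p) (proj₂ p)
    c-ax    : ∀ (a : Ax) (ρ : ℕ → Term ar (Fin n)) →
              Cong n R (evalWith op ρ (lhs a)) (evalWith op ρ (rhs a))

  Presented : (n : ℕ) → Rels n → Alg
  Presented n R = record
    { Carrier = Term ar (Fin n)
    ; _≈_     = Cong n R
    ; isEquiv = record { refl = c-refl ; sym = c-sym ; trans = c-trans }
    ; ⟦_⟧     = op
    ; ⟦⟧-cong = c-cong
    ; sound   = c-ax
    }

  FP : Alg → Set
  FP A = Σ ℕ λ n → Σ (Rels n) λ R → Iso (Presented n R) A

  One : Alg
  One = record
    { Carrier = ⊤ ; _≈_ = λ _ _ → ⊤
    ; isEquiv = record { refl = tt ; sym = λ _ → tt ; trans = λ _ _ → tt }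
    ; ⟦_⟧ = λ _ _ → tt ; ⟦⟧-cong = λ _ _ → tt ; sound = λ _ _ → tt }

  module _ (A B : Alg) where
    private
      module A = Alg A
      module B = Alg B

    ×op : (o : Op) → (Fin (ar o) → A.Carrier × B.Carrier) → A.Carrier × B.Carrier
    ×op o xs = A.⟦ o ⟧ (λ i → proj₁ (xs i)) , B.⟦ o ⟧ (λ i → proj₂ (xs i))

    eval-π₁ : ∀ (ρ : ℕ → A.Carrier × B.Carrier) t →
      A._≈_ (proj₁ (evalWith ×op ρ t)) (evalWith A.⟦_⟧ (λ v → proj₁ (ρ v)) t)
    eval-π₁ ρ (var v)   = IsEquivalence.refl A.isEquiv
    eval-π₁ ρ (op o ts) = A.⟦⟧-cong o (λ i → eval-π₁ ρ (ts i))

    eval-π₂ : ∀ (ρ : ℕ → A.Carrier × B.Carrier) t →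
      B._≈_ (proj₂ (evalWith ×op ρ t)) (evalWith B.⟦_⟧ (λ v → proj₂ (ρ v)) t)
    eval-π₂ ρ (var v)   = IsEquivalence.refl B.isEquiv
    eval-π₂ ρ (op o ts) = B.⟦⟧-cong o (λ i → eval-π₂ ρ (ts i))

    _⊗×_ : Alg
    _⊗×_ = record
      { Carrier = A.Carrier × B.Carrier
      ; _≈_ = λ p q → A._≈_ (proj₁ p) (proj₁ q) × B._≈_ (proj₂ p) (proj₂ q)
      ; isEquiv = record
          { refl  = IsEquivalence.refl A.isEquiv , IsEquivalence.refl B.isEquiv
          ; sym   = λ (p , q) → IsEquivalence.sym A.isEquiv p , IsEquivalence.sym B.isEquiv q
          ; trans = λ (p , q) (p' , q') → IsEquivalence.trans A.isEquiv p p'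
                                        , IsEquivalence.trans B.isEquiv q q' }
      ; ⟦_⟧ = ×op
      ; ⟦⟧-cong = λ o e → A.⟦⟧-cong o (λ i → proj₁ (e i)) , B.⟦⟧-cong o (λ i → proj₂ (e i))
      ; sound = λ a ρ →
          IsEquivalence.trans A.isEquiv (eval-π₁ ρ (lhs a))
            (IsEquivalence.trans A.isEquiv (A.sound a (λ v → proj₁ (ρ v)))
              (IsEquivalence.sym A.isEquiv (eval-π₁ ρ (rhs a))))
          , IsEquivalence.trans B.isEquiv (eval-π₂ ρ (lhs a))
            (IsEquivalence.trans B.isEquiv (B.sound a (λ v → proj₂ (ρ v)))
              (IsEquivalence.sym B.isEquiv (eval-π₂ ρ (rhs a))))
      }

  SubobjectClosed : Set₁
  SubobjectClosed = ∀ (A B : Alg) (m : Hom A B) → Injective A B (proj₁ m) → FP B → FP A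

  StrongQuotientClosed : Set₁
  StrongQuotientClosed = ∀ (A B : Alg) (e : Hom A B) → Surjective A B (proj₁ e) → FP A → FP B

  FiniteProductClosed : Set₁
  FiniteProductClosed = FP One × (∀ (A B : Alg) → FP A → FP B → FP (A ⊗× B))

  Bimorphism : (A B C : Alg) → (∣ A ∣ → ∣ B ∣ → ∣ C ∣) → Set
  Bimorphism A B C f = (∀ a → IsHom B C (f a)) × (∀ b → IsHom A C (λ a → f a b))

  record DMonoid : Set₁ where
    field
      alg    : Alg
      unit   : ∣ alg ∣
      mul    : ∣ alg ∣ → ∣ alg ∣ → ∣ alg ∣
      mul-bi : Bimorphism alg alg alg mul
      assoc  : ∀ x y z → Eq alg (mul (mul x y) z) (mul x (mul y z))
      idˡ    : ∀ x → Eq alg (mul unit x) x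
      idʳ    : ∀ x → Eq alg (mul x unit) x

  open DMonoid public

  IsMonHom : (M N : DMonoid) → (∣ alg M ∣ → ∣ alg N ∣) → Set
  IsMonHom M N h = IsHom (alg M) (alg N) h ×
    Eq (alg N) (h (unit M)) (unit N) ×
    (∀ x y → Eq (alg N) (h (mul M x y)) (mul N (h x) (h y)))

  MonHom : DMonoid → DMonoid → Set
  MonHom M N = Σ (∣ alg M ∣ → ∣ alg N ∣) (IsMonHom M N)

  -- X^⊛ given by its universal property (free 𝒟-monoid on X)
  record FreeMonoid (X : Alg) : Set₁ where
    field
      mon : DMonoid
      η   : Hom X (alg mon)
      ext : ∀ (N : DMonoid) (h : Hom X (alg N)) →
            Σ (MonHom mon N) λ k → ∀ x → Eq (alg N) (proj₁ k (proj₁ η x)) (proj₁ h x)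
      uniq : ∀ (N : DMonoid) (k k' : MonHom mon N) →
             (∀ x → Eq (alg N) (proj₁ k (proj₁ η x)) (proj₁ k' (proj₁ η x))) →
             ∀ w → Eq (alg N) (proj₁ k w) (proj₁ k' w)

  -- automata; δ : X ⊗ Q → Q as a bimorphism X × Q → Q, i : I → Q as an element

  record Automaton (X Y : Alg) : Set₁ where
    field
      Q    : Alg
      δ    : ∣ X ∣ → ∣ Q ∣ → ∣ Q ∣
      δ-bi : Bimorphism X Q Q δ
      i    : ∣ Q ∣
      f    : Hom Q Y

  module Lang (X Y : Alg) (F : FreeMonoid X) (L : Hom (alg (FreeMonoid.mon F)) Y) where
    private
      M⊛ = FreeMonoid.mon F
      W  = alg M⊛
      ε  = unit M⊛
      _·_ = mul M⊛
      η : ∣ X ∣ → ∣ W ∣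
      η = proj₁ (FreeMonoid.η F)

    module _ (A : Automaton X Y) where
      open Automaton A

      -- e_Q : the F-algebra homomorphism from (X^⊛, [i_X, m_X·(η_X⊗X^⊛)])
      IsRun : Hom W Q → Set
      IsRun e = Eq Q (proj₁ e ε) i × (∀ x w → Eq Q (proj₁ e (η x · w)) (δ x (proj₁ e w)))

      Accepts : Set
      Accepts = Σ (Hom W Q) λ e → IsRun e × (∀ w → Eq Y (proj₁ f (proj₁ e w)) (proj₁ L w))

      -- simple: the coalgebra map q ↦ (w ↦ f (δ^⊛ (w , q))) is injective
      Simple : Set
      Simple = Σ (∣ W ∣ → ∣ Q ∣ → ∣ Q ∣) λ δ* → Bimorphism W Q Q δ* ×
        (∀ q → Eq Q (δ* ε q) q) ×
        (∀ x w q → Eq Q (δ* (η x · w) q) (δ x (δ* w q))) ×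
        (∀ q q' → (∀ w → Eq Y (proj₁ f (δ* w q)) (proj₁ f (δ* w q'))) → Eq Q q q')

      -- A is (isomorphic to) Min L: reachable, simple, accepting L
      IsMin : Set
      IsMin = Σ (Hom W Q) (λ e → IsRun e ×
                (∀ w → Eq Y (proj₁ f (proj₁ e w)) (proj₁ L w)) ×
                Surjective W Q (proj₁ e)) × Simple

    Regular : Set₁
    Regular = Σ (Automaton X Y) λ A → FP (Automaton.Q A) × Accepts A

    MinFP : Set₁
    MinFP = Σ (Automaton X Y) λ A → IsMin A × FP (Automaton.Q A)

    Recognizes : (M : DMonoid) → MonHom M⊛ M → Set
    Recognizes M e = Σ (Hom (alg M) Y) λ g → ∀ w → Eq Y (proj₁ g (proj₁ e w)) (proj₁ L w)

    RecFP : Set₁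
    RecFP = Σ DMonoid λ M → FP (alg M) × Σ (MonHom M⊛ M) (Recognizes M)

    -- e is Syn L: smallest surjective recognizer w.r.t. factorization
    IsSyn : (M : DMonoid) → MonHom M⊛ M → Set₁
    IsSyn M e = Surjective W (alg M) (proj₁ e) × Recognizes M e ×
      (∀ (M' : DMonoid) (e' : MonHom M⊛ M') → Surjective W (alg M') (proj₁ e') →
         Recognizes M' e' →
         Σ (MonHom M' M) λ h → ∀ w → Eq (alg M) (proj₁ h (proj₁ e' w)) (proj₁ e w))

    SynFP : Set₁
    SynFP = Σ DMonoid λ M → Σ (MonHom M⊛ M) λ e → IsSyn M e × FP (alg M)

module Submission where

-- An automaton with finitely presentable state object Q accepting L yields a recogniser of L:
-- the monoid of endomorphisms of Q, which is an algebra because the variety is commutative,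
-- and which embeds into Q^n by evaluation at the n generators of Q.  Conversely a recognising
-- monoid is an automaton acting by left multiplication.  Min L and Syn L are the quotients of
-- X^⊛ by the Nerode and the syntactic congruence; these are coarser than the kernel of the run
-- map of any accepting automaton, resp. of any recognising monoid morphism, so Min L and Syn L
-- are strong quotients of subobjects of finitely presentable algebras.

open import Data.Fin using (Fin; zero; suc)
open import Data.Nat using (ℕ; zero; suc)
open import Data.Product using (Σ; _×_; _,_; proj₁; proj₂)
open import Data.Unit using (⊤; tt)
open import Function.Base using (_∘_)
open import Function.Bundles using (_⇔_; mk⇔)
open import Level using (0ℓ)
open import Relation.Binary using (IsEquivalence; Rel; Setoid)
import Relation.Binary.Reasoning.Setoid as SetoidReasoning

open import Defs

module Development (𝒱 : Variety) where
  open Variety 𝒱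
  open Over 𝒱

  module ≈ (A : Alg) = IsEquivalence (Alg.isEquiv A)

  setoid : Alg → Setoid 0ℓ 0ℓ
  setoid A = record { Carrier = ∣ A ∣ ; _≈_ = Eq A ; isEquivalence = Alg.isEquiv A }

  module ≈-Reasoning (A : Alg) = SetoidReasoning (setoid A)

  hom-cong : {A B : Alg} (h : Hom A B) → ∀ {x y} → Eq A x y → Eq B (proj₁ h x) (proj₁ h y)
  hom-cong h = proj₁ (proj₂ h)

  hom-op : {A B : Alg} (h : Hom A B) → ∀ o xs →
           Eq B (proj₁ h (Alg.⟦_⟧ A o xs)) (Alg.⟦_⟧ B o (λ i → proj₁ h (xs i)))
  hom-op h = proj₂ (proj₂ h)

  id-Hom : (A : Alg) → Hom A A
  id-Hom A = (λ a → a) , (λ p → p) , λ o xs → ≈.refl A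

  ∘-Hom : (A B C : Alg) → Hom B C → Hom A B → Hom A C
  ∘-Hom A B C g h =
    (λ a → proj₁ g (proj₁ h a)) ,
    (λ p → hom-cong {B} {C} g (hom-cong {A} {B} h p)) ,
    λ o xs → ≈.trans C (hom-cong {B} {C} g (hom-op {A} {B} h o xs)) (hom-op {B} {C} g o _)

  monHom-hom : (M N : DMonoid) → MonHom M N → Hom (alg M) (alg N)
  monHom-hom M N h = proj₁ h , proj₁ (proj₂ h)

  module _ (M : DMonoid) where

    mulˡ : ∣ alg M ∣ → Hom (alg M) (alg M)
    mulˡ a = mul M a , proj₁ (mul-bi M) a

    mulʳ : ∣ alg M ∣ → Hom (alg M) (alg M)
    mulʳ b = (λ a → mul M a b) , proj₂ (mul-bi M) b

    mul-cong : ∀ {a a' b b'} → Eq (alg M) a a' → Eq (alg M) b b' →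
               Eq (alg M) (mul M a b) (mul M a' b')
    mul-cong {a' = a'} {b} p q =
      ≈.trans (alg M) (hom-cong {alg M} {alg M} (mulʳ b) p) (hom-cong {alg M} {alg M} (mulˡ a') q)

  module _ (B : Alg) {R I : Set} (opᴿ : (o : Op) → (Fin (ar o) → R) → R) (π : I → R → ∣ B ∣)
           (π-op : ∀ i o rs → Eq B (π i (opᴿ o rs)) (Alg.⟦_⟧ B o (λ k → π i (rs k)))) where

    private
      eval-π : ∀ i (ρ : ℕ → R) t →
               Eq B (π i (evalWith opᴿ ρ t)) (evalWith (Alg.⟦_⟧ B) (π i ∘ ρ) t)
      eval-π i ρ (var v)   = ≈.refl B
      eval-π i ρ (op o ts) = ≈.trans B (π-op i o _) (Alg.⟦⟧-cong B o (λ k → eval-π i ρ (ts k)))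

    -- The structure on R that makes the π i jointly injective homomorphisms into B.
    induced : Alg
    induced = record
      { Carrier = R
      ; _≈_     = λ r s → ∀ i → Eq B (π i r) (π i s)
      ; isEquiv = record
          { refl  = λ i → ≈.refl B
          ; sym   = λ p i → ≈.sym B (p i)
          ; trans = λ p q i → ≈.trans B (p i) (q i) }
      ; ⟦_⟧     = opᴿ
      ; ⟦⟧-cong = λ o p i → ≈.trans B (π-op i o _)
                    (≈.trans B (Alg.⟦⟧-cong B o (λ k → p k i)) (≈.sym B (π-op i o _)))
      ; sound   = λ a ρ i → ≈.trans B (eval-π i ρ (lhs a))
                    (≈.trans B (Alg.sound B a (π i ∘ ρ)) (≈.sym B (eval-π i ρ (rhs a))))
      }

  module _ (comm : Commutative) (A : Alg) where

    EndAlg : Alg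
    EndAlg = induced A (λ o hs → (λ a → Alg.⟦_⟧ A o (λ i → proj₁ (hs i) a)) , comm A A o hs)
                       (λ a h → proj₁ h a) (λ a o hs → ≈.refl A)

    End : DMonoid
    End = record
      { alg    = EndAlg
      ; unit   = id-Hom A
      ; mul    = ∘-Hom A A A
      ; mul-bi = (λ g → (λ p a → hom-cong {A} {A} g (p a))
                      , λ o hs a → hom-op {A} {A} g o (λ i → proj₁ (hs i) a))
               , (λ h → (λ p a → p (proj₁ h a)) , λ o hs a → ≈.refl A)
      ; assoc  = λ _ _ _ a → ≈.refl A
      ; idˡ    = λ _ a → ≈.refl A
      ; idʳ    = λ _ a → ≈.refl A
      }

  -- A modulo the intersection of the kernels of the k i.
  module _ (A B : Alg) {I : Set} (k : I → Hom A B) where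

    Quotient : Alg
    Quotient = induced B (Alg.⟦_⟧ A) (λ i → proj₁ (k i)) (λ i → hom-op {A} {B} (k i))

    quotient-map : Hom A Quotient
    quotient-map = (λ a → a) , (λ p i → hom-cong {A} {B} (k i) p) , λ o xs → ≈.refl Quotient

    quotient-map-surjective : Surjective A Quotient (proj₁ quotient-map)
    quotient-map-surjective a = a , ≈.refl Quotient

    factor : (D : Alg) (g : Hom A D) →
             (∀ {a a'} → Eq Quotient a a' → Eq D (proj₁ g a) (proj₁ g a')) → Hom Quotient D
    factor D g respects = proj₁ g , respects , hom-op {A} {D} g

    descend : (h : Hom A A) →
              (∀ {a a'} → Eq Quotient a a' → Eq Quotient (proj₁ h a) (proj₁ h a')) →
              Hom Quotient Quotient
    descend h = factor Quotient (∘-Hom A A Quotient quotient-map h)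

  FP-quotient : SubobjectClosed → StrongQuotientClosed →
    (A B C : Alg) {I : Set} (k : I → Hom A C) (h : Hom A B) →
    (∀ {a a'} → Eq B (proj₁ h a) (proj₁ h a') → Eq (Quotient A C k) a a') →
    FP B → FP (Quotient A C k)
  FP-quotient sub quo A B C k h kernel⊆ fpB =
    quo (Quotient A B kh) (Quotient A C k) coarsen (λ a → a , ≈.refl (Quotient A C k))
        (sub (Quotient A B kh) B (factor A B kh B h (λ p → p tt)) (λ _ _ p _ → p) fpB)
    where
      kh : ⊤ → Hom A B
      kh _ = h
      coarsen : Hom (Quotient A B kh) (Quotient A C k)
      coarsen = factor A B kh (Quotient A C k) (quotient-map A C k) (λ p → kernel⊆ (p tt))

  _^_ : Alg → ℕ → Alg
  A ^ zero  = One
  A ^ suc n = A ⊗× (A ^ n)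

  module _ (A : Alg) where

    tuple : ∀ {n} → (Fin n → ∣ A ∣) → ∣ A ^ n ∣
    tuple {zero}  as = tt
    tuple {suc n} as = as zero , tuple (as ∘ suc)

    tuple-cong : ∀ n {as bs : Fin n → ∣ A ∣} → (∀ j → Eq A (as j) (bs j)) →
                 Eq (A ^ n) (tuple as) (tuple bs)
    tuple-cong zero    p = tt
    tuple-cong (suc n) p = p zero , tuple-cong n (p ∘ suc)

    tuple-injective : ∀ n {as bs : Fin n → ∣ A ∣} → Eq (A ^ n) (tuple as) (tuple bs) →
                      ∀ j → Eq A (as j) (bs j)
    tuple-injective (suc n) (p , ps) zero    = p
    tuple-injective (suc n) (p , ps) (suc j) = tuple-injective n ps j

    tuple-op : ∀ n o (as : Fin (ar o) → Fin n → ∣ A ∣) →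
      Eq (A ^ n) (Alg.⟦_⟧ (A ^ n) o (tuple ∘ as)) (tuple (λ j → Alg.⟦_⟧ A o (λ i → as i j)))
    tuple-op zero    o as = tt
    tuple-op (suc n) o as = ≈.refl A , tuple-op n o (λ i → as i ∘ suc)

    FP-^ : FiniteProductClosed → FP A → ∀ n → FP (A ^ n)
    FP-^ prod fp zero    = proj₁ prod
    FP-^ prod fp (suc n) = proj₂ prod A (A ^ n) fp (FP-^ prod fp n)

  module _ (Q : Alg) (fp : FP Q) where
    private
      P : Alg
      P = Presented (proj₁ fp) (proj₁ (proj₂ fp))
      present : Hom P Q
      present = proj₁ (proj₂ (proj₂ fp))
      unpresent : ∣ Q ∣ → ∣ P ∣
      unpresent = proj₁ (proj₁ (proj₂ (proj₂ (proj₂ fp))))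
      present∘unpresent : ∀ q → Eq Q (proj₁ present (unpresent q)) q
      present∘unpresent = proj₁ (proj₂ (proj₂ (proj₂ (proj₂ fp))))

    generator : Fin (proj₁ fp) → ∣ Q ∣
    generator j = proj₁ present (var j)

    hom-ext : (B : Alg) (φ ψ : Hom Q B) →
              (∀ j → Eq B (proj₁ φ (generator j)) (proj₁ ψ (generator j))) →
              ∀ q → Eq B (proj₁ φ q) (proj₁ ψ q)
    hom-ext B φ ψ agree q = begin
      proj₁ φ q                             ≈⟨ hom-cong {Q} {B} φ (present∘unpresent q) ⟨
      proj₁ φ (proj₁ present (unpresent q)) ≈⟨ on-terms (unpresent q) ⟩
      proj₁ ψ (proj₁ present (unpresent q)) ≈⟨ hom-cong {Q} {B} ψ (present∘unpresent q) ⟩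
      proj₁ ψ q                             ∎
      where
        open ≈-Reasoning B
        φ′ ψ′ : Hom P B
        φ′ = ∘-Hom P Q B φ present
        ψ′ = ∘-Hom P Q B ψ present
        on-terms : ∀ t → Eq B (proj₁ φ′ t) (proj₁ ψ′ t)
        on-terms (var j)   = agree j
        on-terms (op o ts) = begin
          proj₁ φ′ (op o ts)                    ≈⟨ hom-op {P} {B} φ′ o ts ⟩
          Alg.⟦_⟧ B o (λ i → proj₁ φ′ (ts i))   ≈⟨ Alg.⟦⟧-cong B o (on-terms ∘ ts) ⟩
          Alg.⟦_⟧ B o (λ i → proj₁ ψ′ (ts i))   ≈⟨ hom-op {P} {B} ψ′ o ts ⟨
          proj₁ ψ′ (op o ts)                    ∎

  FP-End : (comm : Commutative) → SubobjectClosed → FiniteProductClosed →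
           (Q : Alg) → FP Q → FP (EndAlg comm Q)
  FP-End comm sub prod Q fp =
    sub (EndAlg comm Q) (Q ^ n) evaluate
        (λ φ ψ p → hom-ext Q fp Q φ ψ (tuple-injective Q n p))
        (FP-^ Q prod fp n)
    where
      n : ℕ
      n = proj₁ fp
      evaluate : Hom (EndAlg comm Q) (Q ^ n)
      evaluate = (λ φ → tuple Q (λ j → proj₁ φ (generator Q fp j)))
               , (λ p → tuple-cong Q n (λ j → p (generator Q fp j)))
               , λ o φs → ≈.sym (Q ^ n) (tuple-op Q n o (λ i j → proj₁ (φs i) (generator Q fp j)))

  module FreeMonoidProperties (X : Alg) (F : FreeMonoid X) where

    M⊛ : DMonoid
    M⊛ = FreeMonoid.mon F

    W : Alg
    W = alg M⊛

    ε : ∣ W ∣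
    ε = unit M⊛

    infixl 7 _·_
    _·_ : ∣ W ∣ → ∣ W ∣ → ∣ W ∣
    _·_ = mul M⊛

    η : ∣ X ∣ → ∣ W ∣
    η = proj₁ (FreeMonoid.η F)

    ·-congˡ : ∀ {a b b'} → Eq W b b' → Eq W (a · b) (a · b')
    ·-congˡ = mul-cong M⊛ (≈.refl W)

    ·-congʳ : ∀ {a a' b} → Eq W a a' → Eq W (a · b) (a' · b)
    ·-congʳ p = mul-cong M⊛ p (≈.refl W)

    induction : (P : ∣ W ∣ → Set) → (∀ {v v'} → Eq W v v' → P v → P v') →
      P ε → (∀ x → P (η x)) → (∀ a b → P a → P b → P (a · b)) →
      (∀ o vs → (∀ i → P (vs i)) → P (Alg.⟦_⟧ W o vs)) → ∀ w → P w
    induction P resp P-ε P-η P-· P-op w =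
      resp (FreeMonoid.uniq F M⊛ (forget k) id-MonHom (λ x → proj₂ k-η x tt) w) (proj₂ (proj₁ k w))
      where
        S : Alg
        S = induced W (λ o vs → Alg.⟦_⟧ W o (proj₁ ∘ vs) , P-op o _ (proj₂ ∘ vs))
                      (λ (_ : ⊤) → proj₁) (λ _ o vs → ≈.refl W)
        submonoid : DMonoid
        submonoid = record
          { alg    = S
          ; unit   = ε , P-ε
          ; mul    = λ (a , pa) (b , pb) → a · b , P-· a b pa pb
          ; mul-bi = (λ a → (λ p _ → ·-congˡ (p tt))
                          , λ o vs _ → hom-op {W} {W} (mulˡ M⊛ (proj₁ a)) o _)
                   , (λ b → (λ p _ → ·-congʳ (p tt))
                          , λ o vs _ → hom-op {W} {W} (mulʳ M⊛ (proj₁ b)) o _)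
          ; assoc  = λ a b c _ → assoc M⊛ _ _ _
          ; idˡ    = λ a _ → idˡ M⊛ _
          ; idʳ    = λ a _ → idʳ M⊛ _
          }
        k-η : Σ (MonHom M⊛ submonoid) λ k → ∀ x → Eq S (proj₁ k (η x)) (η x , P-η x)
        k-η = FreeMonoid.ext F submonoid
          ( (λ x → η x , P-η x)
          , (λ p _ → hom-cong {X} {W} (FreeMonoid.η F) p)
          , λ o xs _ → hom-op {X} {W} (FreeMonoid.η F) o xs)
        k : MonHom M⊛ submonoid
        k = proj₁ k-η
        forget : MonHom M⊛ submonoid → MonHom M⊛ M⊛
        forget (h , (h-cong , h-op) , h-ε , h-·) =
            proj₁ ∘ h
          , ((λ p → h-cong p tt) , λ o ws → h-op o ws tt)
          , h-ε tt
          , λ a b → h-· a b tt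
        id-MonHom : MonHom M⊛ M⊛
        id-MonHom = (λ v → v) , proj₂ (id-Hom W) , ≈.refl W , λ _ _ → ≈.refl W

  module Transitions (comm : Commutative) {X Y : Alg} (F : FreeMonoid X) (A : Automaton X Y) where
    open FreeMonoidProperties X F
    open Automaton A

    δ-hom : Hom X (EndAlg comm Q)
    δ-hom = (λ x → δ x , proj₁ δ-bi x)
          , (λ p q → hom-cong {X} {Q} (δ-at q) p)
          , λ o xs q → hom-op {X} {Q} (δ-at q) o xs
      where
        δ-at : ∣ Q ∣ → Hom X Q
        δ-at q = (λ x → δ x q) , proj₂ δ-bi q

    private
      δ*-ext : Σ (MonHom M⊛ (End comm Q)) λ k →
               ∀ x q → Eq Q (proj₁ (proj₁ k (η x)) q) (δ x q)
      δ*-ext = FreeMonoid.ext F (End comm Q) δ-hom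

    δ*-hom : MonHom M⊛ (End comm Q)
    δ*-hom = proj₁ δ*-ext

    δ* : ∣ W ∣ → ∣ Q ∣ → ∣ Q ∣
    δ* w = proj₁ (proj₁ δ*-hom w)

    δ*-η : ∀ x q → Eq Q (δ* (η x) q) (δ x q)
    δ*-η = proj₂ δ*-ext

    δ*-congˡ : ∀ {w w'} → Eq W w w' → ∀ q → Eq Q (δ* w q) (δ* w' q)
    δ*-congˡ = proj₁ (proj₁ (proj₂ δ*-hom))

    δ*-congʳ : ∀ w {q q'} → Eq Q q q' → Eq Q (δ* w q) (δ* w q')
    δ*-congʳ w = hom-cong {Q} {Q} (proj₁ δ*-hom w)

    δ*-op : ∀ o ws q → Eq Q (δ* (Alg.⟦_⟧ W o ws) q) (Alg.⟦_⟧ Q o (λ i → δ* (ws i) q))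
    δ*-op = proj₂ (proj₁ (proj₂ δ*-hom))

    δ*-ε : ∀ q → Eq Q (δ* ε q) q
    δ*-ε = proj₁ (proj₂ (proj₂ δ*-hom))

    δ*-· : ∀ a b q → Eq Q (δ* (a · b) q) (δ* a (δ* b q))
    δ*-· = proj₂ (proj₂ (proj₂ δ*-hom))

    run-· : (e : Hom W Q) → (∀ x w → Eq Q (proj₁ e (η x · w)) (δ x (proj₁ e w))) →
            ∀ v w → Eq Q (proj₁ e (v · w)) (δ* v (proj₁ e w))
    run-· e e-η = induction P resp P-ε P-η P-· P-op
      where
        open ≈-Reasoning Q
        e-cong : ∀ {w w'} → Eq W w w' → Eq Q (proj₁ e w) (proj₁ e w')
        e-cong = hom-cong {W} {Q} e
        P : ∣ W ∣ → Set
        P v = ∀ w → Eq Q (proj₁ e (v · w)) (δ* v (proj₁ e w))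
        resp : ∀ {v v'} → Eq W v v' → P v → P v'
        resp {v} {v'} p Pv w = begin
          proj₁ e (v' · w)    ≈⟨ e-cong (·-congʳ p) ⟨
          proj₁ e (v · w)     ≈⟨ Pv w ⟩
          δ* v (proj₁ e w)    ≈⟨ δ*-congˡ p (proj₁ e w) ⟩
          δ* v' (proj₁ e w)   ∎
        P-ε : P ε
        P-ε w = begin
          proj₁ e (ε · w)     ≈⟨ e-cong (idˡ M⊛ w) ⟩
          proj₁ e w           ≈⟨ δ*-ε (proj₁ e w) ⟨
          δ* ε (proj₁ e w)    ∎
        P-η : ∀ x → P (η x)
        P-η x w = ≈.trans Q (e-η x w) (≈.sym Q (δ*-η x (proj₁ e w)))
        P-· : ∀ a b → P a → P b → P (a · b)
        P-· a b Pa Pb w = begin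
          proj₁ e (a · b · w)         ≈⟨ e-cong (assoc M⊛ a b w) ⟩
          proj₁ e (a · (b · w))       ≈⟨ Pa (b · w) ⟩
          δ* a (proj₁ e (b · w))      ≈⟨ δ*-congʳ a (Pb w) ⟩
          δ* a (δ* b (proj₁ e w))     ≈⟨ δ*-· a b (proj₁ e w) ⟨
          δ* (a · b) (proj₁ e w)      ∎
        P-op : ∀ o vs → (∀ i → P (vs i)) → P (Alg.⟦_⟧ W o vs)
        P-op o vs Pvs w = begin
          proj₁ e (Alg.⟦_⟧ W o vs · w)
            ≈⟨ hom-op {W} {Q} (∘-Hom W W Q e (mulʳ M⊛ w)) o vs ⟩
          Alg.⟦_⟧ Q o (λ i → proj₁ e (vs i · w))     ≈⟨ Alg.⟦⟧-cong Q o (λ i → Pvs i w) ⟩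
          Alg.⟦_⟧ Q o (λ i → δ* (vs i) (proj₁ e w))  ≈⟨ δ*-op o vs (proj₁ e w) ⟨
          δ* (Alg.⟦_⟧ W o vs) (proj₁ e w)            ∎

  module Language (X Y : Alg) (F : FreeMonoid X) (L : Hom (alg (FreeMonoid.mon F)) Y) where
    open FreeMonoidProperties X F
    open Lang X Y F L

    L-cong : ∀ {w w'} → Eq W w w' → Eq Y (proj₁ L w) (proj₁ L w')
    L-cong = hom-cong {W} {Y} L

    leftContext : ∣ W ∣ → Hom W Y
    leftContext v = ∘-Hom W W Y L (mulˡ M⊛ v)

    context : ∣ W ∣ × ∣ W ∣ → Hom W Y
    context (u , v) = ∘-Hom W W Y L (∘-Hom W W W (mulˡ M⊛ u) (mulʳ M⊛ v))

    Nerode : Alg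
    Nerode = Quotient W Y leftContext

    _∼_ : Rel ∣ W ∣ 0ℓ
    _∼_ = Eq Nerode

    Syntactic : Alg
    Syntactic = Quotient W Y context

    _≋_ : Rel ∣ W ∣ 0ℓ
    _≋_ = Eq Syntactic

    ∼-·ˡ : ∀ a {w w'} → w ∼ w' → (a · w) ∼ (a · w')
    ∼-·ˡ a {w} {w'} p v = begin
      proj₁ L (v · (a · w))   ≈⟨ L-cong (assoc M⊛ v a w) ⟨
      proj₁ L (v · a · w)     ≈⟨ p (v · a) ⟩
      proj₁ L (v · a · w')    ≈⟨ L-cong (assoc M⊛ v a w') ⟩
      proj₁ L (v · (a · w'))  ∎
      where open ≈-Reasoning Y

    ≋-·ˡ : ∀ a {w w'} → w ≋ w' → (a · w) ≋ (a · w')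
    ≋-·ˡ a {w} {w'} p (u , v) = begin
      proj₁ L (u · (a · w · v))     ≈⟨ L-cong (rebracket w) ⟩
      proj₁ L (u · a · (w · v))     ≈⟨ p (u · a , v) ⟩
      proj₁ L (u · a · (w' · v))    ≈⟨ L-cong (rebracket w') ⟨
      proj₁ L (u · (a · w' · v))    ∎
      where
        open ≈-Reasoning Y
        rebracket : ∀ w → Eq W (u · (a · w · v)) (u · a · (w · v))
        rebracket w = ≈.trans W (·-congˡ (assoc M⊛ a w v)) (≈.sym W (assoc M⊛ u a (w · v)))

    ≋-·ʳ : ∀ b {w w'} → w ≋ w' → (w · b) ≋ (w' · b)
    ≋-·ʳ b {w} {w'} p (u , v) = begin
      proj₁ L (u · (w · b · v))     ≈⟨ L-cong (·-congˡ (assoc M⊛ w b v)) ⟩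
      proj₁ L (u · (w · (b · v)))   ≈⟨ p (u , b · v) ⟩
      proj₁ L (u · (w' · (b · v)))  ≈⟨ L-cong (·-congˡ (assoc M⊛ w' b v)) ⟨
      proj₁ L (u · (w' · b · v))    ∎
      where open ≈-Reasoning Y

    L-on-Nerode : Hom Nerode Y
    L-on-Nerode = factor W Y leftContext Y L λ {w} {w'} p →
      ≈.trans Y (L-cong (≈.sym W (idˡ M⊛ w))) (≈.trans Y (p ε) (L-cong (idˡ M⊛ w')))

    L-on-Syntactic : Hom Syntactic Y
    L-on-Syntactic = factor W Y context Y L λ {w} {w'} p →
      ≈.trans Y (L-cong (≈.sym W (ε·w·ε w))) (≈.trans Y (p (ε , ε)) (L-cong (ε·w·ε w')))
      where
        ε·w·ε : ∀ w → Eq W (ε · (w · ε)) w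
        ε·w·ε w = ≈.trans W (idˡ M⊛ (w · ε)) (idʳ M⊛ w)

    minimal : Automaton X Y
    minimal = record
      { Q    = Nerode
      ; δ    = λ x w → η x · w
      ; δ-bi = (λ x → proj₂ (descend W Y leftContext (mulˡ M⊛ (η x)) (∼-·ˡ (η x))))
             , (λ w → proj₂ (∘-Hom X W Nerode
                                (∘-Hom W W Nerode (quotient-map W Y leftContext) (mulʳ M⊛ w))
                                (FreeMonoid.η F)))
      ; i    = ε
      ; f    = L-on-Nerode
      }

    minimal-isMin : IsMin minimal
    minimal-isMin =
      ( quotient-map W Y leftContext
      , (≈.refl Nerode , λ x w → ≈.refl Nerode)
      , (λ w → ≈.refl Y)
      , quotient-map-surjective W Y leftContext )
      , _·_
      , ( (λ a → proj₂ (descend W Y leftContext (mulˡ M⊛ a) (∼-·ˡ a)))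
        , (λ q → proj₂ (∘-Hom W W Nerode (quotient-map W Y leftContext) (mulʳ M⊛ q))) )
      , (λ q → W⇒∼ (idˡ M⊛ q))
      , (λ x w q → W⇒∼ (assoc M⊛ (η x) w q))
      , λ q q' observed → observed
      where
        W⇒∼ : ∀ {w w'} → Eq W w w' → w ∼ w'
        W⇒∼ = hom-cong {W} {Nerode} (quotient-map W Y leftContext)

    syntactic : DMonoid
    syntactic = record
      { alg    = Syntactic
      ; unit   = ε
      ; mul    = _·_
      ; mul-bi = (λ a → proj₂ (descend W Y context (mulˡ M⊛ a) (≋-·ˡ a)))
               , (λ b → proj₂ (descend W Y context (mulʳ M⊛ b) (≋-·ʳ b)))
      ; assoc  = λ a b c → W⇒≋ (assoc M⊛ a b c)
      ; idˡ    = λ a → W⇒≋ (idˡ M⊛ a)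
      ; idʳ    = λ a → W⇒≋ (idʳ M⊛ a)
      }
      where
        W⇒≋ : ∀ {w w'} → Eq W w w' → w ≋ w'
        W⇒≋ = hom-cong {W} {Syntactic} (quotient-map W Y context)

    syntactic-map : MonHom M⊛ syntactic
    syntactic-map =
      (λ w → w) , proj₂ (quotient-map W Y context) , ≈.refl Syntactic , λ _ _ → ≈.refl Syntactic

    recognizer-kernel⊆≋ : (M : DMonoid) (e : MonHom M⊛ M) → Recognizes M e →
      ∀ {w w'} → Eq (alg M) (proj₁ e w) (proj₁ e w') → w ≋ w'
    recognizer-kernel⊆≋ M (e , _ , _ , e-·) (g , g-e) {w} {w'} p (u , v) = begin
      proj₁ L (u · (w · v))         ≈⟨ expand w ⟩
      proj₁ g (e u ∙ (e w ∙ e v))   ≈⟨ hom-cong {alg M} {Y} g (∙-cong M.refl (∙-cong p M.refl)) ⟩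
      proj₁ g (e u ∙ (e w' ∙ e v))  ≈⟨ expand w' ⟨
      proj₁ L (u · (w' · v))        ∎
      where
        open ≈-Reasoning Y
        module M = ≈ (alg M)
        _∙_ = mul M
        ∙-cong = mul-cong M
        expand : ∀ w → Eq Y (proj₁ L (u · (w · v))) (proj₁ g (e u ∙ (e w ∙ e v)))
        expand w = ≈.trans Y (≈.sym Y (g-e _))
          (hom-cong {alg M} {Y} g (M.trans (e-· u (w · v)) (∙-cong M.refl (e-· w v))))

    syntactic-least : (M : DMonoid) (e : MonHom M⊛ M) → Surjective W (alg M) (proj₁ e) →
      (∀ {w w'} → Eq (alg M) (proj₁ e w) (proj₁ e w') → w ≋ w') →
      Σ (MonHom M syntactic) λ h → ∀ w → proj₁ h (proj₁ e w) ≋ w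
    syntactic-least M (e , (_ , e-op) , e-ε , e-·) surjective kernel⊆≋ =
      (h , (h-cong , h-op) , h-ε , h-·) , λ w → kernel⊆≋ (e∘h (e w))
      where
        module M = ≈ (alg M)
        h : ∣ alg M ∣ → ∣ W ∣
        h m = proj₁ (surjective m)
        e∘h : ∀ m → Eq (alg M) (e (h m)) m
        e∘h m = proj₂ (surjective m)
        h-cong : ∀ {m m'} → Eq (alg M) m m' → h m ≋ h m'
        h-cong {m} {m'} p = kernel⊆≋ (M.trans (e∘h m) (M.trans p (M.sym (e∘h m'))))
        h-op : ∀ o ms → h (Alg.⟦_⟧ (alg M) o ms) ≋ Alg.⟦_⟧ W o (h ∘ ms)
        h-op o ms = kernel⊆≋ (M.trans (e∘h _)
          (M.trans (Alg.⟦⟧-cong (alg M) o (M.sym ∘ e∘h ∘ ms)) (M.sym (e-op o (h ∘ ms)))))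
        h-ε : h (unit M) ≋ ε
        h-ε = kernel⊆≋ (M.trans (e∘h _) (M.sym e-ε))
        h-· : ∀ m m' → h (mul M m m') ≋ (h m · h m')
        h-· m m' = kernel⊆≋ (M.trans (e∘h _)
          (M.trans (M.sym (mul-cong M (e∘h m) (e∘h m'))) (M.sym (e-· (h m) (h m')))))

    syntactic-isSyn : IsSyn syntactic syntactic-map
    syntactic-isSyn =
      quotient-map-surjective W Y context , (L-on-Syntactic , λ w → ≈.refl Y) ,
      λ M e surjective recognizes →
        syntactic-least M e surjective (recognizer-kernel⊆≋ M e recognizes)

    regular⇒minFP : Commutative → SubobjectClosed → StrongQuotientClosed → Regular → MinFP
    regular⇒minFP comm sub quo (A , fpQ , e , (_ , e-η) , accepts) =
      minimal , minimal-isMin , FP-quotient sub quo W Q Y leftContext e kernel⊆∼ fpQ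
      where
        open Automaton A
        open Transitions comm F A
        open ≈-Reasoning Y
        f-cong : ∀ {q q'} → Eq Q q q' → Eq Y (proj₁ f q) (proj₁ f q')
        f-cong = hom-cong {Q} {Y} f
        kernel⊆∼ : ∀ {w w'} → Eq Q (proj₁ e w) (proj₁ e w') → w ∼ w'
        kernel⊆∼ {w} {w'} p v = begin
          proj₁ L (v · w)               ≈⟨ accepts (v · w) ⟨
          proj₁ f (proj₁ e (v · w))     ≈⟨ f-cong (run-· e e-η v w) ⟩
          proj₁ f (δ* v (proj₁ e w))    ≈⟨ f-cong (δ*-congʳ v p) ⟩
          proj₁ f (δ* v (proj₁ e w'))   ≈⟨ f-cong (run-· e e-η v w') ⟨
          proj₁ f (proj₁ e (v · w'))    ≈⟨ accepts (v · w') ⟩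
          proj₁ L (v · w')              ∎

    minFP⇒regular : MinFP → Regular
    minFP⇒regular (A , ((e , run , accepts , _) , _) , fp) = A , fp , e , run , accepts

    regular⇒recFP : Commutative → SubobjectClosed → FiniteProductClosed → Regular → RecFP
    regular⇒recFP comm sub prod (A , fpQ , e , (e-ε , e-η) , accepts) =
      End comm Q , FP-End comm sub prod Q fpQ , δ*-hom , output , recognizes
      where
        open Automaton A
        open Transitions comm F A
        open ≈-Reasoning Y
        f-cong : ∀ {q q'} → Eq Q q q' → Eq Y (proj₁ f q) (proj₁ f q')
        f-cong = hom-cong {Q} {Y} f
        output : Hom (EndAlg comm Q) Y
        output = (λ φ → proj₁ f (proj₁ φ i))
               , (λ p → f-cong (p i))
               , λ o φs → hom-op {Q} {Y} f o _
        recognizes : ∀ w → Eq Y (proj₁ f (δ* w i)) (proj₁ L w)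
        recognizes w = begin
          proj₁ f (δ* w i)             ≈⟨ f-cong (δ*-congʳ w e-ε) ⟨
          proj₁ f (δ* w (proj₁ e ε))   ≈⟨ f-cong (run-· e e-η w ε) ⟨
          proj₁ f (proj₁ e (w · ε))    ≈⟨ f-cong (hom-cong {W} {Q} e (idʳ M⊛ w)) ⟩
          proj₁ f (proj₁ e w)          ≈⟨ accepts w ⟩
          proj₁ L w                    ∎

    recFP⇒synFP : SubobjectClosed → StrongQuotientClosed → RecFP → SynFP
    recFP⇒synFP sub quo (M , fpM , e , recognizes) =
      syntactic , syntactic-map , syntactic-isSyn ,
      FP-quotient sub quo W (alg M) Y context (monHom-hom M⊛ M e)
                  (recognizer-kernel⊆≋ M e recognizes) fpM

    synFP⇒recFP : SynFP → RecFP
    synFP⇒recFP (M , e , (_ , recognizes , _) , fp) = M , fp , e , recognizes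

    recFP⇒regular : RecFP → Regular
    recFP⇒regular (M , fp , e , g , g-e) =
      A , fp , e-hom , (e-ε , λ x w → e-· (η x) w) , g-e
      where
        e-hom : Hom W (alg M)
        e-hom = monHom-hom M⊛ M e
        e-ε : Eq (alg M) (proj₁ e ε) (unit M)
        e-ε = proj₁ (proj₂ (proj₂ e))
        e-· : ∀ a b → Eq (alg M) (proj₁ e (a · b)) (mul M (proj₁ e a) (proj₁ e b))
        e-· = proj₂ (proj₂ (proj₂ e))
        A : Automaton X Y
        A = record
          { Q    = alg M
          ; δ    = λ x m → mul M (proj₁ e (η x)) m
          ; δ-bi = (λ x → proj₁ (mul-bi M) (proj₁ e (η x)))
                 , (λ m → proj₂ (∘-Hom X W (alg M) (∘-Hom W (alg M) (alg M) (mulʳ M m) e-hom)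
                                                   (FreeMonoid.η F)))
          ; i    = unit M
          ; f    = g
          }

theorem53 : (𝒱 : Variety) → let open Over 𝒱 in
    Commutative → SubobjectClosed → StrongQuotientClosed → FiniteProductClosed →
    (X Y : Alg) (F : FreeMonoid X) (L : Hom (alg (FreeMonoid.mon F)) Y) →
    (Lang.Regular X Y F L ⇔ Lang.MinFP X Y F L) ×
    (Lang.Regular X Y F L ⇔ Lang.RecFP X Y F L) ×
    (Lang.Regular X Y F L ⇔ Lang.SynFP X Y F L)
theorem53 𝒱 comm sub quo prod X Y F L =
    mk⇔ (regular⇒minFP comm sub quo) minFP⇒regular
  , mk⇔ (regular⇒recFP comm sub prod) recFP⇒regular
  , mk⇔ (recFP⇒synFP sub quo ∘ regular⇒recFP comm sub prod) (recFP⇒regular ∘ synFP⇒recFP)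
  where open Development.Language 𝒱 X Y F L
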